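{- The $\pi$-calculus is strongly replacement free: for every $\pi$-calculus context $C$, every invisible $\pi$-calculus process $I$ and every $\pi$-calculus process $P$, if $C[I]\Downarrow$ then $C[P]\Downarrow$.
   Context: The $\pi$-calculus is Milner–Parrow–Walker's $\pi$-calculus (without the match operator) with its standard labelled transition semantics; input, output and bound output actions are visible, $\tau$ is invisible. A context is a term with one hole $[\cdot]$; $C[P]$ is the result of filling the hole with $P$. $\Rightarrow$ is the reflexive-transitive closure of $\xrightarrow{\tau}$. $P\Downarrow$ iff there exist a visible action $\alpha$ and $P'$ with $P\Rightarrow\xrightarrow{\alpha}\Rightarrow P'$; $P$ is invisible iff not $P\Downarrow$. -}

module Defs where

-- Milner–Parrow–Walker π-calculus without match, with de Bruijn names,
-- and its standard (late) labelled transition semantics.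

open import Data.Nat using (ℕ; zero; suc)
open import Data.Product using (∃; ∃-syntax; _×_; _,_)
open import Relation.Nullary using (¬_)

Name : Set
Name = ℕ

-- Processes.  Names are de Bruijn indices; `inp a P` binds index 0 in P,
-- `ν P` binds index 0 in P.
data Proc : Set where
  𝟘    : Proc
  inp  : Name → Proc → Proc
  out  : Name → Name → Proc → Proc
  tau  : Proc → Proc
  _⊕_  : Proc → Proc → Proc
  _∥_  : Proc → Proc → Proc
  ν    : Proc → Proc
  !_   : Proc → Proc

ext : (Name → Name) → Name → Name
ext ρ zero    = zero
ext ρ (suc n) = suc (ρ n)

rename : (Name → Name) → Proc → Proc
rename ρ 𝟘         = 𝟘
rename ρ (inp a P) = inp (ρ a) (rename (ext ρ) P)
rename ρ (out a b P) = out (ρ a) (ρ b) (rename ρ P)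
rename ρ (tau P)   = tau (rename ρ P)
rename ρ (P ⊕ Q)   = rename ρ P ⊕ rename ρ Q
rename ρ (P ∥ Q)   = rename ρ P ∥ rename ρ Q
rename ρ (ν P)     = ν (rename (ext ρ) P)
rename ρ (! P)     = ! rename ρ P

shift : Proc → Proc
shift = rename suc

subst0 : Name → Name → Name
subst0 b zero    = b
subst0 b (suc n) = n

_[0≔_] : Proc → Name → Proc
P [0≔ b ] = rename (subst0 b) P

swap01 : Name → Name
swap01 zero          = suc zero
swap01 (suc zero)    = zero
swap01 (suc (suc n)) = suc (suc n)

-- Actions.  `inA a` is the (late, bound) input a(x): the continuation binds
-- index 0; `boutA a` is the bound output ā(x): the continuation binds index 0.
data Act : Set where
  τA    : Act
  inA   : Name → Act
  outA  : Name → Name → Act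
  boutA : Name → Act

infix 4 _─[_]→_
data _─[_]→_ : Proc → Act → Proc → Set where
  inp-ax  : ∀ {a P}   → inp a P ─[ inA a ]→ P
  out-ax  : ∀ {a b P} → out a b P ─[ outA a b ]→ P
  tau-ax  : ∀ {P}     → tau P ─[ τA ]→ P
  sumˡ : ∀ {P Q α P'} → P ─[ α ]→ P' → P ⊕ Q ─[ α ]→ P'
  sumʳ : ∀ {P Q α Q'} → Q ─[ α ]→ Q' → P ⊕ Q ─[ α ]→ Q'
  parˡ-τ   : ∀ {P Q P'}     → P ─[ τA ]→ P' → P ∥ Q ─[ τA ]→ P' ∥ Q
  parʳ-τ   : ∀ {P Q Q'}     → Q ─[ τA ]→ Q' → P ∥ Q ─[ τA ]→ P ∥ Q'
  parˡ-out : ∀ {P Q P' a b} → P ─[ outA a b ]→ P' → P ∥ Q ─[ outA a b ]→ P' ∥ Q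
  parʳ-out : ∀ {P Q Q' a b} → Q ─[ outA a b ]→ Q' → P ∥ Q ─[ outA a b ]→ P ∥ Q'
  parˡ-in   : ∀ {P Q P' a} → P ─[ inA a ]→ P' → P ∥ Q ─[ inA a ]→ P' ∥ shift Q
  parʳ-in   : ∀ {P Q Q' a} → Q ─[ inA a ]→ Q' → P ∥ Q ─[ inA a ]→ shift P ∥ Q'
  parˡ-bout : ∀ {P Q P' a} → P ─[ boutA a ]→ P' → P ∥ Q ─[ boutA a ]→ P' ∥ shift Q
  parʳ-bout : ∀ {P Q Q' a} → Q ─[ boutA a ]→ Q' → P ∥ Q ─[ boutA a ]→ shift P ∥ Q'
  comˡ : ∀ {P Q P' Q' a b} → P ─[ outA a b ]→ P' → Q ─[ inA a ]→ Q' →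
         P ∥ Q ─[ τA ]→ P' ∥ (Q' [0≔ b ])
  comʳ : ∀ {P Q P' Q' a b} → P ─[ inA a ]→ P' → Q ─[ outA a b ]→ Q' →
         P ∥ Q ─[ τA ]→ (P' [0≔ b ]) ∥ Q'
  closeˡ : ∀ {P Q P' Q' a} → P ─[ boutA a ]→ P' → Q ─[ inA a ]→ Q' →
           P ∥ Q ─[ τA ]→ ν (P' ∥ Q')
  closeʳ : ∀ {P Q P' Q' a} → P ─[ inA a ]→ P' → Q ─[ boutA a ]→ Q' →
           P ∥ Q ─[ τA ]→ ν (P' ∥ Q')
  res-τ    : ∀ {P P'}     → P ─[ τA ]→ P' → ν P ─[ τA ]→ ν P'
  res-out  : ∀ {P P' a b} → P ─[ outA (suc a) (suc b) ]→ P' → ν P ─[ outA a b ]→ ν P'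
  res-in   : ∀ {P P' a}   → P ─[ inA (suc a) ]→ P' → ν P ─[ inA a ]→ ν (rename swap01 P')
  res-bout : ∀ {P P' a}   → P ─[ boutA (suc a) ]→ P' → ν P ─[ boutA a ]→ ν (rename swap01 P')
  open′ : ∀ {P P' a} → P ─[ outA (suc a) zero ]→ P' → ν P ─[ boutA a ]→ P'
  rep : ∀ {P α P'} → P ∥ (! P) ─[ α ]→ P' → ! P ─[ α ]→ P'

data Visible : Act → Set where
  vis-in   : ∀ {a}   → Visible (inA a)
  vis-out  : ∀ {a b} → Visible (outA a b)
  vis-bout : ∀ {a}   → Visible (boutA a)

infix 4 _⇒_
data _⇒_ : Proc → Proc → Set where
  ⇒-refl : ∀ {P} → P ⇒ P
  ⇒-step : ∀ {P Q R} → P ─[ τA ]→ Q → Q ⇒ R → P ⇒ R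

_⇓ : Proc → Set
P ⇓ = ∃[ α ] ∃[ P₁ ] ∃[ P₂ ] ∃[ P' ]
        (Visible α × P ⇒ P₁ × P₁ ─[ α ]→ P₂ × P₂ ⇒ P')

Invisible : Proc → Set
Invisible P = ¬ (P ⇓)

data Ctx : Set where
  ●     : Ctx
  inpC  : Name → Ctx → Ctx
  outC  : Name → Name → Ctx → Ctx
  tauC  : Ctx → Ctx
  _⊕C_  : Ctx → Proc → Ctx
  _C⊕_  : Proc → Ctx → Ctx
  _∥C_  : Ctx → Proc → Ctx
  _C∥_  : Proc → Ctx → Ctx
  νC    : Ctx → Ctx
  !C_   : Ctx → Ctx

-- hole filling (syntactic: names of the plugged process may be captured
-- by binders around the hole, as with named syntax)
_[_] : Ctx → Proc → Proc
● [ P ]          = P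
inpC a C [ P ]   = inp a (C [ P ])
outC a b C [ P ] = out a b (C [ P ])
tauC C [ P ]     = tau (C [ P ])
(C ⊕C Q) [ P ]   = (C [ P ]) ⊕ Q
(Q C⊕ C) [ P ]   = Q ⊕ (C [ P ])
(C ∥C Q) [ P ]   = (C [ P ]) ∥ Q
(Q C∥ C) [ P ]   = Q ∥ (C [ P ])
νC C [ P ]       = ν (C [ P ])
(!C C) [ P ]     = ! (C [ P ])

-- Let ⊑ be generated by the process constructors, by relating every
-- invisible process to every process, and by the τ-free unfolding of sums
-- and replications on the right.
-- Each step of the left side of ⊑ is either a τ-step inside an invisible
-- part, after which the sides are still related, or is matched by a step
-- with the same label on the right: an invisible process can neither do a
-- visible action nor take part in a communication.  Hence weak barbs move
-- from C[I] to C[P].  As transitions substitute names, ⊑ must be closed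
-- under renaming, i.e. invisibility must be: a renaming can create new
-- communications only by identifying names, and the process then already
-- had a visible action.
module Submission where

open import Defs
open import Data.Nat using (zero; suc)
open import Data.Nat.Properties using (_≟_; suc-injective)
open import Data.Product using (Σ; ∃-syntax; _×_; _,_)
open import Data.Sum using (_⊎_; inj₁; inj₂)
open import Data.Empty using (⊥-elim)
open import Function using (_∘_)
open import Relation.Nullary using (yes; no)
open import Relation.Binary.PropositionalEquality
  using (_≡_; _≢_; refl; sym; cong; cong₂; module ≡-Reasoning)

private
  variable
    ρ f g h : Name → Name
    P P' Q Q' R A A' B B' : Proc
    α : Act

ext-fusion : (∀ n → f (g n) ≡ h n) → ∀ n → ext f (ext g n) ≡ ext h n
ext-fusion e zero    = refl
ext-fusion e (suc n) = cong suc (e n)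

rename-fusion : (∀ n → f (g n) ≡ h n) → ∀ P → rename f (rename g P) ≡ rename h P
rename-fusion e 𝟘         = refl
rename-fusion e (inp a P) = cong₂ inp (e a) (rename-fusion (ext-fusion e) P)
rename-fusion e (out a b P) =
  cong₂ (λ x y → x y) (cong₂ out (e a) (e b)) (rename-fusion e P)
rename-fusion e (tau P)   = cong tau (rename-fusion e P)
rename-fusion e (P ⊕ Q)   = cong₂ _⊕_ (rename-fusion e P) (rename-fusion e Q)
rename-fusion e (P ∥ Q)   = cong₂ _∥_ (rename-fusion e P) (rename-fusion e Q)
rename-fusion e (ν P)     = cong ν (rename-fusion (ext-fusion e) P)
rename-fusion e (! P)     = cong !_ (rename-fusion e P)

module _ (ρ : Name → Name) where
  open ≡-Reasoning

  rename-ext-shift : ∀ Q → rename (ext ρ) (shift Q) ≡ shift (rename ρ Q)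
  rename-ext-shift Q = begin
    rename (ext ρ) (rename suc Q) ≡⟨ rename-fusion (λ _ → refl) Q ⟩
    rename (suc ∘ ρ) Q            ≡⟨ rename-fusion (λ _ → refl) Q ⟨
    rename suc (rename ρ Q)       ∎

  rename-swap01-ext² : ∀ Q →
    rename swap01 (rename (ext (ext ρ)) Q) ≡ rename (ext (ext ρ)) (rename swap01 Q)
  rename-swap01-ext² Q = begin
    rename swap01 (rename (ext (ext ρ)) Q) ≡⟨ rename-fusion (λ _ → refl) Q ⟩
    rename (swap01 ∘ ext (ext ρ)) Q        ≡⟨ rename-fusion swap01-ext² Q ⟨
    rename (ext (ext ρ)) (rename swap01 Q) ∎
    where
    swap01-ext² : ∀ n → ext (ext ρ) (swap01 n) ≡ swap01 (ext (ext ρ) n)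
    swap01-ext² zero          = refl
    swap01-ext² (suc zero)    = refl
    swap01-ext² (suc (suc n)) = refl

  rename-subst0-ext : ∀ b Q →
    rename (subst0 (ρ b)) (rename (ext ρ) Q) ≡ rename ρ (Q [0≔ b ])
  rename-subst0-ext b Q = begin
    rename (subst0 (ρ b)) (rename (ext ρ) Q) ≡⟨ rename-fusion subst0-ext Q ⟩
    rename (ρ ∘ subst0 b) Q                  ≡⟨ rename-fusion (λ _ → refl) Q ⟨
    rename ρ (rename (subst0 b) Q)           ∎
    where
    subst0-ext : ∀ n → subst0 (ρ b) (ext ρ n) ≡ ρ (subst0 b n)
    subst0-ext zero    = refl
    subst0-ext (suc n) = refl

⇓-intro : P ⇒ Q → Visible α → Q ─[ α ]→ R → P ⇓
⇓-intro w v t = _ , _ , _ , _ , v , w , t , ⇒-refl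

⇓-τ-step : P ─[ τA ]→ Q → Q ⇓ → P ⇓
⇓-τ-step s (α , Q₁ , Q₂ , Q' , v , w , t , w') = α , Q₁ , Q₂ , Q' , v , ⇒-step s w , t , w'

subject : Visible α → Name
subject (vis-in {a})   = a
subject (vis-out {a})  = a
subject (vis-bout {a}) = a

-- A visible action of Q whose subject ρ identifies with another name: the
-- only way for rename ρ Q to communicate where Q cannot.
Clash : (Name → Name) → Proc → Set
Clash ρ Q = Σ Act λ β → Σ Proc λ Q' → Σ (Visible β) λ v → Q ─[ β ]→ Q' ×
            ∃[ a ] a ≢ subject v × ρ (subject v) ≡ ρ a

Reflected : (Name → Name) → Proc → Act → Proc → Set
Reflected ρ Q τA R = (∃[ R₀ ] Q ─[ τA ]→ R₀ × R ≡ rename ρ R₀) ⊎ Clash ρ Q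
Reflected ρ Q (outA a b) R = ∃[ a' ] ∃[ b' ] ∃[ Q' ]
  Q ─[ outA a' b' ]→ Q' × ρ a' ≡ a × ρ b' ≡ b × R ≡ rename ρ Q'
Reflected ρ Q (inA a) R = ∃[ a' ] ∃[ Q' ]
  Q ─[ inA a' ]→ Q' × ρ a' ≡ a × R ≡ rename (ext ρ) Q'
Reflected ρ Q (boutA a) R = ∃[ a' ] ∃[ Q' ]
  Q ─[ boutA a' ]→ Q' × ρ a' ≡ a × R ≡ rename (ext ρ) Q'

Reflected-map : (∀ {β S} → Q ─[ β ]→ S → Q' ─[ β ]→ S) →
                Reflected ρ Q α R → Reflected ρ Q' α R
Reflected-map {α = τA} f (inj₁ (R₀ , t , e)) = inj₁ (R₀ , f t , e)
Reflected-map {α = τA} f (inj₂ (β , S , v , t , c)) = inj₂ (β , S , v , f t , c)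
Reflected-map {α = inA _} f (a , S , t , e) = a , S , f t , e
Reflected-map {α = outA _ _} f (a , b , S , t , e) = a , b , S , f t , e
Reflected-map {α = boutA _} f (a , S , t , e) = a , S , f t , e

Clash-parˡ : Clash ρ A → Clash ρ (A ∥ B)
Clash-parˡ (_ , _ , vis-in   , t , c) = _ , _ , vis-in   , parˡ-in t   , c
Clash-parˡ (_ , _ , vis-out  , t , c) = _ , _ , vis-out  , parˡ-out t  , c
Clash-parˡ (_ , _ , vis-bout , t , c) = _ , _ , vis-bout , parˡ-bout t , c

Clash-parʳ : Clash ρ B → Clash ρ (A ∥ B)
Clash-parʳ (_ , _ , vis-in   , t , c) = _ , _ , vis-in   , parʳ-in t   , c
Clash-parʳ (_ , _ , vis-out  , t , c) = _ , _ , vis-out  , parʳ-out t  , c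
Clash-parʳ (_ , _ , vis-bout , t , c) = _ , _ , vis-bout , parʳ-bout t , c

-- The other name cannot be the restricted one, as ext ρ keeps 0 apart.
Clash-ν : Clash (ext ρ) Q → Clash ρ (ν Q)
Clash-ν (_ , _ , vis-in {zero} , _ , zero , a≢ , _) = ⊥-elim (a≢ refl)
Clash-ν (_ , _ , vis-in {zero} , _ , suc _ , _ , ())
Clash-ν (_ , _ , vis-in {suc _} , _ , zero , _ , ())
Clash-ν (_ , _ , vis-in {suc _} , t , suc a , a≢ , e) =
  _ , _ , vis-in , res-in t , a , a≢ ∘ cong suc , suc-injective e
Clash-ν (_ , _ , vis-out {zero} , _ , zero , a≢ , _) = ⊥-elim (a≢ refl)
Clash-ν (_ , _ , vis-out {zero} , _ , suc _ , _ , ())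
Clash-ν (_ , _ , vis-out {suc _} , _ , zero , _ , ())
Clash-ν (_ , _ , vis-out {suc _} {zero} , t , suc a , a≢ , e) =
  _ , _ , vis-bout , open′ t , a , a≢ ∘ cong suc , suc-injective e
Clash-ν (_ , _ , vis-out {suc _} {suc _} , t , suc a , a≢ , e) =
  _ , _ , vis-out , res-out t , a , a≢ ∘ cong suc , suc-injective e
Clash-ν (_ , _ , vis-bout {zero} , _ , zero , a≢ , _) = ⊥-elim (a≢ refl)
Clash-ν (_ , _ , vis-bout {zero} , _ , suc _ , _ , ())
Clash-ν (_ , _ , vis-bout {suc _} , _ , zero , _ , ())
Clash-ν (_ , _ , vis-bout {suc _} , t , suc a , a≢ , e) =
  _ , _ , vis-bout , res-bout t , a , a≢ ∘ cong suc , suc-injective e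

mutual
  reflect-rename : ∀ ρ Q → rename ρ Q ─[ α ]→ R → Reflected ρ Q α R
  reflect-rename ρ 𝟘 ()
  reflect-rename ρ (inp a Q) inp-ax = a , Q , inp-ax , refl , refl
  reflect-rename ρ (out a b Q) out-ax = a , b , Q , out-ax , refl , refl , refl
  reflect-rename ρ (tau Q) tau-ax = inj₁ (Q , tau-ax , refl)
  reflect-rename ρ (Q₁ ⊕ Q₂) (sumˡ t) = Reflected-map sumˡ (reflect-rename ρ Q₁ t)
  reflect-rename ρ (Q₁ ⊕ Q₂) (sumʳ t) = Reflected-map sumʳ (reflect-rename ρ Q₂ t)
  reflect-rename ρ (! Q) (rep t) = Reflected-map rep (reflect-rename-∥ ρ Q (! Q) t)
  reflect-rename ρ (Q₁ ∥ Q₂) t = reflect-rename-∥ ρ Q₁ Q₂ t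
  reflect-rename ρ (ν Q) t = reflect-rename-ν ρ Q t

  reflect-rename-∥ : ∀ ρ Q₁ Q₂ → rename ρ Q₁ ∥ rename ρ Q₂ ─[ α ]→ R →
                     Reflected ρ (Q₁ ∥ Q₂) α R
  reflect-rename-∥ ρ Q₁ Q₂ (parˡ-τ t) with reflect-rename ρ Q₁ t
  ... | inj₁ (R₀ , s , refl) = inj₁ (R₀ ∥ Q₂ , parˡ-τ s , refl)
  ... | inj₂ c = inj₂ (Clash-parˡ c)
  reflect-rename-∥ ρ Q₁ Q₂ (parʳ-τ t) with reflect-rename ρ Q₂ t
  ... | inj₁ (R₀ , s , refl) = inj₁ (Q₁ ∥ R₀ , parʳ-τ s , refl)
  ... | inj₂ c = inj₂ (Clash-parʳ c)
  reflect-rename-∥ ρ Q₁ Q₂ (parˡ-out t) with reflect-rename ρ Q₁ t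
  ... | a , b , S , s , e₁ , e₂ , refl = a , b , S ∥ Q₂ , parˡ-out s , e₁ , e₂ , refl
  reflect-rename-∥ ρ Q₁ Q₂ (parʳ-out t) with reflect-rename ρ Q₂ t
  ... | a , b , S , s , e₁ , e₂ , refl = a , b , Q₁ ∥ S , parʳ-out s , e₁ , e₂ , refl
  reflect-rename-∥ ρ Q₁ Q₂ (parˡ-in t) with reflect-rename ρ Q₁ t
  ... | a , S , s , e , refl =
    a , S ∥ shift Q₂ , parˡ-in s , e , cong (_ ∥_) (sym (rename-ext-shift ρ Q₂))
  reflect-rename-∥ ρ Q₁ Q₂ (parʳ-in t) with reflect-rename ρ Q₂ t
  ... | a , S , s , e , refl =
    a , shift Q₁ ∥ S , parʳ-in s , e , cong (_∥ _) (sym (rename-ext-shift ρ Q₁))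
  reflect-rename-∥ ρ Q₁ Q₂ (parˡ-bout t) with reflect-rename ρ Q₁ t
  ... | a , S , s , e , refl =
    a , S ∥ shift Q₂ , parˡ-bout s , e , cong (_ ∥_) (sym (rename-ext-shift ρ Q₂))
  reflect-rename-∥ ρ Q₁ Q₂ (parʳ-bout t) with reflect-rename ρ Q₂ t
  ... | a , S , s , e , refl =
    a , shift Q₁ ∥ S , parʳ-bout s , e , cong (_∥ _) (sym (rename-ext-shift ρ Q₁))
  reflect-rename-∥ ρ Q₁ Q₂ (comˡ t₁ t₂)
    with reflect-rename ρ Q₁ t₁ | reflect-rename ρ Q₂ t₂
  ... | a₁ , b , S₁ , s₁ , refl , refl , refl | a₂ , S₂ , s₂ , e , refl with a₁ ≟ a₂
  ...   | yes refl = inj₁ (_ , comˡ s₁ s₂ , cong (_ ∥_) (rename-subst0-ext ρ b S₂))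
  ...   | no a₁≢a₂ = inj₂ (_ , _ , vis-out , parˡ-out s₁ , a₂ , a₁≢a₂ ∘ sym , sym e)
  reflect-rename-∥ ρ Q₁ Q₂ (comʳ t₁ t₂)
    with reflect-rename ρ Q₁ t₁ | reflect-rename ρ Q₂ t₂
  ... | a₁ , S₁ , s₁ , e , refl | a₂ , b , S₂ , s₂ , refl , refl , refl with a₂ ≟ a₁
  ...   | yes refl = inj₁ (_ , comʳ s₁ s₂ , cong (_∥ _) (rename-subst0-ext ρ b S₁))
  ...   | no a₂≢a₁ = inj₂ (_ , _ , vis-out , parʳ-out s₂ , a₁ , a₂≢a₁ ∘ sym , sym e)
  reflect-rename-∥ ρ Q₁ Q₂ (closeˡ t₁ t₂)
    with reflect-rename ρ Q₁ t₁ | reflect-rename ρ Q₂ t₂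
  ... | a₁ , S₁ , s₁ , refl , refl | a₂ , S₂ , s₂ , e , refl with a₁ ≟ a₂
  ...   | yes refl = inj₁ (_ , closeˡ s₁ s₂ , refl)
  ...   | no a₁≢a₂ = inj₂ (_ , _ , vis-bout , parˡ-bout s₁ , a₂ , a₁≢a₂ ∘ sym , sym e)
  reflect-rename-∥ ρ Q₁ Q₂ (closeʳ t₁ t₂)
    with reflect-rename ρ Q₁ t₁ | reflect-rename ρ Q₂ t₂
  ... | a₁ , S₁ , s₁ , e , refl | a₂ , S₂ , s₂ , refl , refl with a₂ ≟ a₁
  ...   | yes refl = inj₁ (_ , closeʳ s₁ s₂ , refl)
  ...   | no a₂≢a₁ = inj₂ (_ , _ , vis-bout , parʳ-bout s₂ , a₁ , a₂≢a₁ ∘ sym , sym e)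

  reflect-rename-ν : ∀ ρ Q → ν (rename (ext ρ) Q) ─[ α ]→ R → Reflected ρ (ν Q) α R
  reflect-rename-ν ρ Q (res-τ t) with reflect-rename (ext ρ) Q t
  ... | inj₁ (R₀ , s , refl) = inj₁ (ν R₀ , res-τ s , refl)
  ... | inj₂ c = inj₂ (Clash-ν c)
  reflect-rename-ν ρ Q (res-out t) with reflect-rename (ext ρ) Q t
  ... | zero , _ , _ , _ , () , _
  ... | suc _ , zero , _ , _ , _ , () , _
  ... | suc a , suc b , S , s , refl , refl , refl = a , b , ν S , res-out s , refl , refl , refl
  reflect-rename-ν ρ Q (res-in t) with reflect-rename (ext ρ) Q t
  ... | zero , _ , _ , () , _
  ... | suc a , S , s , refl , refl =
    a , ν (rename swap01 S) , res-in s , refl , cong ν (rename-swap01-ext² ρ S)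
  reflect-rename-ν ρ Q (res-bout t) with reflect-rename (ext ρ) Q t
  ... | zero , _ , _ , () , _
  ... | suc a , S , s , refl , refl =
    a , ν (rename swap01 S) , res-bout s , refl , cong ν (rename-swap01-ext² ρ S)
  reflect-rename-ν ρ Q (open′ t) with reflect-rename (ext ρ) Q t
  ... | zero , _ , _ , _ , () , _
  ... | suc _ , suc _ , _ , _ , _ , () , _
  ... | suc a , zero , S , s , refl , refl , refl = a , S , open′ s , refl , refl

Reflected-visible-⇓ : Visible α → Reflected ρ Q α R → Q ⇓
Reflected-visible-⇓ vis-in   (_ , _ , s , _)     = ⇓-intro ⇒-refl vis-in s
Reflected-visible-⇓ vis-out  (_ , _ , _ , s , _) = ⇓-intro ⇒-refl vis-out s
Reflected-visible-⇓ vis-bout (_ , _ , s , _)     = ⇓-intro ⇒-refl vis-bout s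

rename-⇓ : ∀ ρ Q → rename ρ Q ⇒ Q' → Visible α → Q' ─[ α ]→ R → Q ⇓
rename-⇓ ρ Q ⇒-refl v t = Reflected-visible-⇓ v (reflect-rename ρ Q t)
rename-⇓ ρ Q (⇒-step u w) v t with reflect-rename ρ Q u
... | inj₁ (Q₀ , s , refl) = ⇓-τ-step s (rename-⇓ ρ Q₀ w v t)
... | inj₂ (_ , _ , v' , s , _) = ⇓-intro ⇒-refl v' s

Invisible-rename : ∀ ρ → Invisible P → Invisible (rename ρ P)
Invisible-rename {P} ρ inv (_ , _ , _ , _ , v , w , t , _) = inv (rename-⇓ ρ P w v t)

infix 4 _⊑_
data _⊑_ : Proc → Proc → Set where
  ⊑-invisible : Invisible P → P ⊑ Q
  ⊑-𝟘         : 𝟘 ⊑ 𝟘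
  ⊑-inp       : ∀ {a} → A ⊑ A' → inp a A ⊑ inp a A'
  ⊑-out       : ∀ {a b} → A ⊑ A' → out a b A ⊑ out a b A'
  ⊑-tau       : A ⊑ A' → tau A ⊑ tau A'
  ⊑-⊕         : A ⊑ A' → B ⊑ B' → A ⊕ B ⊑ A' ⊕ B'
  ⊑-∥         : A ⊑ A' → B ⊑ B' → A ∥ B ⊑ A' ∥ B'
  ⊑-ν         : A ⊑ A' → ν A ⊑ ν A'
  ⊑-!         : A ⊑ A' → ! A ⊑ ! A'
  ⊑-unfold    : A ⊑ A' ∥ (! A') → A ⊑ ! A'
  ⊑-sumˡ      : A ⊑ A' → A ⊑ A' ⊕ B'
  ⊑-sumʳ      : A ⊑ A' → A ⊑ B' ⊕ A'

⊑-refl : ∀ P → P ⊑ P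
⊑-refl 𝟘           = ⊑-𝟘
⊑-refl (inp a P)   = ⊑-inp (⊑-refl P)
⊑-refl (out a b P) = ⊑-out (⊑-refl P)
⊑-refl (tau P)     = ⊑-tau (⊑-refl P)
⊑-refl (P ⊕ Q)     = ⊑-⊕ (⊑-refl P) (⊑-refl Q)
⊑-refl (P ∥ Q)     = ⊑-∥ (⊑-refl P) (⊑-refl Q)
⊑-refl (ν P)       = ⊑-ν (⊑-refl P)
⊑-refl (! P)       = ⊑-! (⊑-refl P)

⊑-plug : ∀ C → Invisible P → C [ P ] ⊑ C [ Q ]
⊑-plug ●            inv = ⊑-invisible inv
⊑-plug (inpC a C)   inv = ⊑-inp (⊑-plug C inv)
⊑-plug (outC a b C) inv = ⊑-out (⊑-plug C inv)
⊑-plug (tauC C)     inv = ⊑-tau (⊑-plug C inv)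
⊑-plug (C ⊕C R)     inv = ⊑-⊕ (⊑-plug C inv) (⊑-refl R)
⊑-plug (R C⊕ C)     inv = ⊑-⊕ (⊑-refl R) (⊑-plug C inv)
⊑-plug (C ∥C R)     inv = ⊑-∥ (⊑-plug C inv) (⊑-refl R)
⊑-plug (R C∥ C)     inv = ⊑-∥ (⊑-refl R) (⊑-plug C inv)
⊑-plug (νC C)       inv = ⊑-ν (⊑-plug C inv)
⊑-plug (!C C)       inv = ⊑-! (⊑-plug C inv)

⊑-rename : ∀ ρ → P ⊑ Q → rename ρ P ⊑ rename ρ Q
⊑-rename ρ (⊑-invisible inv) = ⊑-invisible (Invisible-rename ρ inv)
⊑-rename ρ ⊑-𝟘          = ⊑-𝟘
⊑-rename ρ (⊑-inp r)    = ⊑-inp (⊑-rename (ext ρ) r)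
⊑-rename ρ (⊑-out r)    = ⊑-out (⊑-rename ρ r)
⊑-rename ρ (⊑-tau r)    = ⊑-tau (⊑-rename ρ r)
⊑-rename ρ (⊑-⊕ r s)    = ⊑-⊕ (⊑-rename ρ r) (⊑-rename ρ s)
⊑-rename ρ (⊑-∥ r s)    = ⊑-∥ (⊑-rename ρ r) (⊑-rename ρ s)
⊑-rename ρ (⊑-ν r)      = ⊑-ν (⊑-rename (ext ρ) r)
⊑-rename ρ (⊑-! r)      = ⊑-! (⊑-rename ρ r)
⊑-rename ρ (⊑-unfold r) = ⊑-unfold (⊑-rename ρ r)
⊑-rename ρ (⊑-sumˡ r)   = ⊑-sumˡ (⊑-rename ρ r)
⊑-rename ρ (⊑-sumʳ r)   = ⊑-sumʳ (⊑-rename ρ r)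

Matched : Proc → Act → Proc → Set
Matched Q α R = (α ≡ τA × R ⊑ Q) ⊎ (∃[ R' ] Q ─[ α ]→ R' × R ⊑ R')

Matched-visible : Visible α → Matched Q α R → ∃[ R' ] Q ─[ α ]→ R' × R ⊑ R'
Matched-visible vis-in   (inj₁ (() , _))
Matched-visible vis-out  (inj₁ (() , _))
Matched-visible vis-bout (inj₁ (() , _))
Matched-visible _        (inj₂ m) = m

Matched-map : (∀ {β S} → Q ─[ β ]→ S → Q' ─[ β ]→ S) → (∀ {S} → S ⊑ Q → S ⊑ Q') →
              Matched Q α R → Matched Q' α R
Matched-map step rel (inj₁ (e , r)) = inj₁ (e , rel r)
Matched-map step rel (inj₂ (R' , s , r)) = inj₂ (R' , step s , r)

Matched-τ-cong : {k g : Proc → Proc} → (∀ {S S'} → S ⊑ S' → k S ⊑ g S') →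
                 (∀ {S} → Q ─[ τA ]→ S → g Q ─[ τA ]→ g S) →
                 Matched Q τA R → Matched (g Q) τA (k R)
Matched-τ-cong rel step (inj₁ (e , r)) = inj₁ (e , rel r)
Matched-τ-cong rel step (inj₂ (R' , s , r)) = inj₂ (_ , step s , rel r)

invisible-step : Invisible P → P ─[ α ]→ R → Matched Q α R
invisible-step {α = τA}      inv t = inj₁ (refl , ⊑-invisible (inv ∘ ⇓-τ-step t))
invisible-step {α = inA _}   inv t = ⊥-elim (inv (⇓-intro ⇒-refl vis-in t))
invisible-step {α = outA _ _} inv t = ⊥-elim (inv (⇓-intro ⇒-refl vis-out t))
invisible-step {α = boutA _} inv t = ⊥-elim (inv (⇓-intro ⇒-refl vis-bout t))

mutual
  ⊑-simulate : P ⊑ Q → P ─[ α ]→ R → Matched Q α R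
  ⊑-simulate (⊑-invisible inv) t = invisible-step inv t
  ⊑-simulate (⊑-unfold r) t = Matched-map rep ⊑-unfold (⊑-simulate r t)
  ⊑-simulate (⊑-sumˡ r) t = Matched-map sumˡ ⊑-sumˡ (⊑-simulate r t)
  ⊑-simulate (⊑-sumʳ r) t = Matched-map sumʳ ⊑-sumʳ (⊑-simulate r t)
  ⊑-simulate ⊑-𝟘 ()
  ⊑-simulate (⊑-inp r) inp-ax = inj₂ (_ , inp-ax , r)
  ⊑-simulate (⊑-out r) out-ax = inj₂ (_ , out-ax , r)
  ⊑-simulate (⊑-tau r) tau-ax = inj₂ (_ , tau-ax , r)
  ⊑-simulate (⊑-⊕ r _) (sumˡ t) = Matched-map sumˡ ⊑-sumˡ (⊑-simulate r t)
  ⊑-simulate (⊑-⊕ _ r) (sumʳ t) = Matched-map sumʳ ⊑-sumʳ (⊑-simulate r t)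
  ⊑-simulate (⊑-! r) (rep t) = Matched-map rep ⊑-unfold (⊑-simulate-∥ r (⊑-! r) t)
  ⊑-simulate (⊑-∥ r₁ r₂) t = ⊑-simulate-∥ r₁ r₂ t
  ⊑-simulate (⊑-ν r) t = ⊑-simulate-ν r t

  ⊑-simulate-∥ : A ⊑ A' → B ⊑ B' → A ∥ B ─[ α ]→ R → Matched (A' ∥ B') α R
  ⊑-simulate-∥ r₁ r₂ (parˡ-τ t) = Matched-τ-cong (λ r → ⊑-∥ r r₂) parˡ-τ (⊑-simulate r₁ t)
  ⊑-simulate-∥ r₁ r₂ (parʳ-τ t) = Matched-τ-cong (⊑-∥ r₁) parʳ-τ (⊑-simulate r₂ t)
  ⊑-simulate-∥ r₁ r₂ (parˡ-out t) with Matched-visible vis-out (⊑-simulate r₁ t)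
  ... | _ , s , r = inj₂ (_ , parˡ-out s , ⊑-∥ r r₂)
  ⊑-simulate-∥ r₁ r₂ (parʳ-out t) with Matched-visible vis-out (⊑-simulate r₂ t)
  ... | _ , s , r = inj₂ (_ , parʳ-out s , ⊑-∥ r₁ r)
  ⊑-simulate-∥ r₁ r₂ (parˡ-in t) with Matched-visible vis-in (⊑-simulate r₁ t)
  ... | _ , s , r = inj₂ (_ , parˡ-in s , ⊑-∥ r (⊑-rename suc r₂))
  ⊑-simulate-∥ r₁ r₂ (parʳ-in t) with Matched-visible vis-in (⊑-simulate r₂ t)
  ... | _ , s , r = inj₂ (_ , parʳ-in s , ⊑-∥ (⊑-rename suc r₁) r)
  ⊑-simulate-∥ r₁ r₂ (parˡ-bout t) with Matched-visible vis-bout (⊑-simulate r₁ t)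
  ... | _ , s , r = inj₂ (_ , parˡ-bout s , ⊑-∥ r (⊑-rename suc r₂))
  ⊑-simulate-∥ r₁ r₂ (parʳ-bout t) with Matched-visible vis-bout (⊑-simulate r₂ t)
  ... | _ , s , r = inj₂ (_ , parʳ-bout s , ⊑-∥ (⊑-rename suc r₁) r)
  ⊑-simulate-∥ r₁ r₂ (comˡ {b = b} t₁ t₂)
    with Matched-visible vis-out (⊑-simulate r₁ t₁) | Matched-visible vis-in (⊑-simulate r₂ t₂)
  ... | _ , s₁ , q₁ | _ , s₂ , q₂ = inj₂ (_ , comˡ s₁ s₂ , ⊑-∥ q₁ (⊑-rename (subst0 b) q₂))
  ⊑-simulate-∥ r₁ r₂ (comʳ {b = b} t₁ t₂)
    with Matched-visible vis-in (⊑-simulate r₁ t₁) | Matched-visible vis-out (⊑-simulate r₂ t₂)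
  ... | _ , s₁ , q₁ | _ , s₂ , q₂ = inj₂ (_ , comʳ s₁ s₂ , ⊑-∥ (⊑-rename (subst0 b) q₁) q₂)
  ⊑-simulate-∥ r₁ r₂ (closeˡ t₁ t₂)
    with Matched-visible vis-bout (⊑-simulate r₁ t₁) | Matched-visible vis-in (⊑-simulate r₂ t₂)
  ... | _ , s₁ , q₁ | _ , s₂ , q₂ = inj₂ (_ , closeˡ s₁ s₂ , ⊑-ν (⊑-∥ q₁ q₂))
  ⊑-simulate-∥ r₁ r₂ (closeʳ t₁ t₂)
    with Matched-visible vis-in (⊑-simulate r₁ t₁) | Matched-visible vis-bout (⊑-simulate r₂ t₂)
  ... | _ , s₁ , q₁ | _ , s₂ , q₂ = inj₂ (_ , closeʳ s₁ s₂ , ⊑-ν (⊑-∥ q₁ q₂))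

  ⊑-simulate-ν : A ⊑ A' → ν A ─[ α ]→ R → Matched (ν A') α R
  ⊑-simulate-ν r (res-τ t) = Matched-τ-cong ⊑-ν res-τ (⊑-simulate r t)
  ⊑-simulate-ν r (res-out t) with Matched-visible vis-out (⊑-simulate r t)
  ... | _ , s , q = inj₂ (_ , res-out s , ⊑-ν q)
  ⊑-simulate-ν r (res-in t) with Matched-visible vis-in (⊑-simulate r t)
  ... | _ , s , q = inj₂ (_ , res-in s , ⊑-ν (⊑-rename swap01 q))
  ⊑-simulate-ν r (res-bout t) with Matched-visible vis-bout (⊑-simulate r t)
  ... | _ , s , q = inj₂ (_ , res-bout s , ⊑-ν (⊑-rename swap01 q))
  ⊑-simulate-ν r (open′ t) with Matched-visible vis-out (⊑-simulate r t)
  ... | _ , s , q = inj₂ (_ , open′ s , q)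

⊑-simulate-⇒ : P ⊑ Q → P ⇒ P' → ∃[ Q' ] Q ⇒ Q' × P' ⊑ Q'
⊑-simulate-⇒ r ⇒-refl = _ , ⇒-refl , r
⊑-simulate-⇒ r (⇒-step t w) with ⊑-simulate r t
... | inj₁ (_ , r') = ⊑-simulate-⇒ r' w
... | inj₂ (_ , s , r') with ⊑-simulate-⇒ r' w
...   | Q' , w' , r'' = Q' , ⇒-step s w' , r''

⊑-⇓ : P ⊑ Q → P ⇓ → Q ⇓
⊑-⇓ r (_ , _ , _ , _ , v , w , t , _) with ⊑-simulate-⇒ r w
... | _ , w' , r' with Matched-visible v (⊑-simulate r' t)
...   | _ , s , _ = ⇓-intro w' v s

theorem3p6 : (C : Ctx) (I P : Proc) → Invisible I → (C [ I ]) ⇓ → (C [ P ]) ⇓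
theorem3p6 C I P inv = ⊑-⇓ (⊑-plug C inv)
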